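{- Let $m,l\ge1$, $n=m+l-1$, $\sigma\in S_m$, $\alpha\in S_l$. Suppose there are integers $i_1<\dots<i_s<a$ with $a\ge1$, $a+1\le m$, such that $\operatorname{RLmax}\sigma=\{i_1,\dots,i_s,a\}\cup[a+1,m]$, and an integer $b$ with $\operatorname{RLmax}\alpha=[b-a,l]$. Let $\sigma'=\sigma(\alpha,a+1)$. Then $\operatorname{RLmax}\sigma'=\{i_1,\dots,i_s,a\}\cup[b,n]$.
   Context: $[x,y]=\{x,\dots,y\}$. $\operatorname{RLmax}\pi$ is the set of indices $i$ with $\pi_i>\pi_j$ for all $j>i$. Inflation: for $\sigma\in S_m$, $\alpha\in S_l$ and $1\le a+1\le m$, $\sigma(\alpha,a+1)$ is the permutation of length $l+m-1$ given by $\hat\sigma_1\ldots\hat\sigma_a\,\hat\alpha_1\ldots\hat\alpha_l\,\hat\sigma_{a+2}\ldots\hat\sigma_m$, where $\hat\alpha_i=\alpha_i+\sigma_{a+1}-1$, and $\hat\sigma_i=\sigma_i$ if $\sigma_i<\sigma_{a+1}$, $\hat\sigma_i=\sigma_i+l-1$ otherwise. -}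

module Defs where

open import Data.Nat using (ℕ; zero; suc; _+_; _∸_; _≤_; _<_)
open import Data.Nat.Properties using (_<?_)
open import Data.List using (List; []; _∷_; length; map; take; drop; _++_; applyUpTo)
open import Data.List.Relation.Binary.Permutation.Propositional using (_↭_)
open import Data.Product using (_×_)
open import Relation.Nullary.Decidable using (does)
open import Data.Bool using (if_then_else_)

-- Permutations in one-line notation: σ ∈ S_m is a list that is a
-- rearrangement of [1, 2, ..., m].
IsPerm : ℕ → List ℕ → Set
IsPerm m σ = σ ↭ applyUpTo suc m

-- 1-based entry σ_i (value 0 outside the range [1, length σ], never used there).
at : List ℕ → ℕ → ℕ
at []       _             = 0
at (x ∷ xs) zero          = 0
at (x ∷ xs) (suc zero)    = x
at (x ∷ xs) (suc (suc k)) = at xs (suc k)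

IsRLmax : List ℕ → ℕ → Set
IsRLmax σ i = (1 ≤ i) × (i ≤ length σ)
            × (∀ j → i < j → j ≤ length σ → at σ j < at σ i)

-- Inflation σ(α, a+1) for σ ∈ S_m, α ∈ S_l:
--   σ̂_1 … σ̂_a α̂_1 … α̂_l σ̂_{a+2} … σ̂_m
-- with α̂_i = α_i + σ_{a+1} - 1, σ̂_i = σ_i if σ_i < σ_{a+1}, else σ_i + l - 1.
inflate : List ℕ → List ℕ → ℕ → List ℕ
inflate σ α a =
  map hat (take a σ) ++ map (λ x → x + c ∸ 1) α ++ map hat (drop (suc a) σ)
  where
  c : ℕ
  c = at σ (suc a)
  hat : ℕ → ℕ
  hat x = if does (x <? c) then x else x + (length α ∸ 1)

-- The relabelling σ ↦ σ̂ is strictly increasing and leaves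
-- the tail unchanged, since a+1 ∈ RLmax σ puts every tail entry below σ_{a+1}; the α̂-block fills
-- exactly the values σ_{a+1}, …, σ_{a+1}+l-1 that σ̂ jumps over. Hence a position of the first block
-- is an RL maximum of σ' iff it is one of σ, a position a+k of the α̂-block iff k is one of α, and
-- every position of the tail is one, because every position a+2, …, m of σ is.
module Submission where

open import Defs
open import Data.Bool using (if_then_else_; true; false)
open import Data.List using (List; []; _∷_; length; map; take; drop; _++_)
open import Data.List.Properties using (length-map; length-take; length-applyUpTo)
open import Data.List.Membership.Propositional using (_∈_)
open import Data.List.Membership.Propositional.Properties using (∈-applyUpTo⁺; ∈-applyUpTo⁻)
open import Data.List.Relation.Binary.Permutation.Propositional using (↭-sym)
open import Data.List.Relation.Binary.Permutation.Propositional.Properties using (↭-length; ∈-resp-↭)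
open import Data.List.Relation.Unary.All as All using (All; []; _∷_)
open import Data.List.Relation.Unary.All.Properties using (++⁺; ++⁻; map⁺; map⁻)
open import Data.List.Relation.Unary.Linked using (Linked)
open import Data.Nat using (ℕ; zero; suc; _+_; _∸_; _≤_; _<_; z≤n; s≤s; z<s; _<ᵇ_)
open import Data.Nat.Properties
open import Data.Nat.Tactic.RingSolver using (solve-∀)
open import Data.Product using (_×_; _,_; proj₁; proj₂; uncurry)
open import Data.Product.Function.NonDependent.Propositional using (_×-⇔_)
open import Data.Sum using (_⊎_; inj₁; inj₂)
open import Data.Sum.Function.Propositional using (_⊎-⇔_)
open import Function.Base using (_∘_)
open import Function.Bundles using (_⇔_; mk⇔; Equivalence)
open import Function.Properties.Equivalence using () renaming (refl to ⇔-refl; sym to ⇔-sym; trans to ⇔-trans)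
open import Function.Related.Propositional using (module EquationalReasoning; equivalence)
open import Relation.Binary.Definitions using (tri<; tri≈; tri>)
open import Relation.Binary.PropositionalEquality using (_≡_; refl; cong; cong₂; subst; subst₂; sym; trans)
open import Relation.Nullary.Decidable using (does)
open import Relation.Nullary.Negation using (contradiction)
open import Relation.Nullary.Reflects using (ofʸ; ofⁿ)
open import Relation.Unary using (U)

open Equivalence using (to; from)
open EquationalReasoning {k = equivalence}

private variable
  P : ℕ → Set
  x l : ℕ
  xs ys α : List ℕ

All-at : All P xs → ∀ {k} → suc k ≤ length xs → P (at xs (suc k))
All-at (px ∷ _)  {zero}  _       = px
All-at (_ ∷ pxs) {suc k} (s≤s p) = All-at pxs p

All-tabulate-at : ∀ xs → (∀ k → suc k ≤ length xs → P (at xs (suc k))) → All P xs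
All-tabulate-at []       _ = []
All-tabulate-at (x ∷ xs) h = h 0 (s≤s z≤n) ∷ All-tabulate-at xs (λ k → h (suc k) ∘ s≤s)

at-map : ∀ (f : ℕ → ℕ) xs {k} → suc k ≤ length xs → at (map f xs) (suc k) ≡ f (at xs (suc k))
at-map f (x ∷ xs) {zero}  _       = refl
at-map f (x ∷ xs) {suc k} (s≤s p) = at-map f xs p

All-++⇔ : All P (xs ++ ys) ⇔ (All P xs × All P ys)
All-++⇔ {xs = xs} = mk⇔ (++⁻ xs) (uncurry ++⁺)

All-∷⇔ : (P x × All P xs) ⇔ All P (x ∷ xs)
All-∷⇔ = mk⇔ (uncurry _∷_) All.uncons

take++at∷drop : ∀ a (xs : List ℕ) → a < length xs → take a xs ++ at xs (suc a) ∷ drop (suc a) xs ≡ xs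
take++at∷drop zero    (x ∷ xs) _       = refl
take++at∷drop (suc a) (x ∷ xs) (s≤s p) = cong (x ∷_) (take++at∷drop a xs p)

length-take-≤ : ∀ a (xs : List ℕ) → a ≤ length xs → length (take a xs) ≡ a
length-take-≤ a xs a≤∣xs∣ = trans (length-take a xs) (m≤n⇒m⊓n≡m a≤∣xs∣)

IsRLmax-∷-head : ∀ x xs → IsRLmax (x ∷ xs) 1 ⇔ All (_< x) xs
IsRLmax-∷-head x xs = mk⇔
  (λ (_ , _ , h) → All-tabulate-at xs (λ k p → h (suc (suc k)) (s≤s (s≤s z≤n)) (s≤s p)))
  (λ xs<x → s≤s z≤n , s≤s z≤n , later xs<x)
  where
  later : All (_< x) xs → ∀ j → 1 < j → j ≤ length (x ∷ xs) → at (x ∷ xs) j < x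
  later xs<x (suc (suc j)) _        (s≤s p) = All-at xs<x p
  later xs<x (suc zero)    (s≤s ()) _

IsRLmax-∷-tail : ∀ x xs k → IsRLmax (x ∷ xs) (suc (suc k)) ⇔ IsRLmax xs (suc k)
IsRLmax-∷-tail x xs k = mk⇔
  (λ { (_ , s≤s p , h) → s≤s z≤n , p , λ { (suc j) q r → h (suc (suc j)) (s≤s q) (s≤s r) } })
  (λ { (_ , p , h) → s≤s z≤n , s≤s p , λ { (suc (suc j)) (s≤s q) (s≤s r) → h (suc j) q r
                                        ; (suc zero)    (s≤s ()) _ } })

IsRLmax-last : ∀ {n} xs → length xs ≡ suc n → IsRLmax xs (suc n)
IsRLmax-last xs ∣xs∣≡1+n = s≤s z≤n , ≤-reflexive (sym ∣xs∣≡1+n) ,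
  λ j n<j j≤∣xs∣ → contradiction (subst (j ≤_) ∣xs∣≡1+n j≤∣xs∣) (<⇒≱ n<j)

IsRLmax-++ˡ : ∀ xs ys {i} → i ≤ length xs →
              IsRLmax (xs ++ ys) i ⇔ (IsRLmax xs i × All (_< at xs i) ys)
IsRLmax-++ˡ xs       ys {zero}        _       = mk⇔ (λ { (() , _) }) (λ { ((() , _) , _) })
IsRLmax-++ˡ (x ∷ xs) ys {suc zero}    _       = begin
  IsRLmax (x ∷ xs ++ ys) 1             ∼⟨ IsRLmax-∷-head x (xs ++ ys) ⟩
  All (_< x) (xs ++ ys)                ∼⟨ All-++⇔ ⟩
  (All (_< x) xs × All (_< x) ys)      ∼⟨ ⇔-sym (IsRLmax-∷-head x xs) ×-⇔ ⇔-refl ⟩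
  (IsRLmax (x ∷ xs) 1 × All (_< x) ys) ∎
IsRLmax-++ˡ (x ∷ xs) ys {suc (suc k)} (s≤s p) = begin
  IsRLmax (x ∷ xs ++ ys) (suc (suc k))                          ∼⟨ IsRLmax-∷-tail x (xs ++ ys) k ⟩
  IsRLmax (xs ++ ys) (suc k)                                    ∼⟨ IsRLmax-++ˡ xs ys p ⟩
  (IsRLmax xs (suc k) × All (_< at xs (suc k)) ys)             ∼⟨ ⇔-sym (IsRLmax-∷-tail x xs k) ×-⇔ ⇔-refl ⟩
  (IsRLmax (x ∷ xs) (suc (suc k)) × All (_< at xs (suc k)) ys) ∎

IsRLmax-++ʳ : ∀ xs ys {n} → length xs ≡ n → ∀ k → IsRLmax (xs ++ ys) (n + suc k) ⇔ IsRLmax ys (suc k)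
IsRLmax-++ʳ []       ys refl k = ⇔-refl
IsRLmax-++ʳ (x ∷ xs) ys refl k = begin
  IsRLmax (x ∷ xs ++ ys) (suc (length xs + suc k))   ≡⟨ cong (IsRLmax (x ∷ xs ++ ys) ∘ suc) (+-suc (length xs) k) ⟩
  IsRLmax (x ∷ xs ++ ys) (suc (suc (length xs + k))) ∼⟨ IsRLmax-∷-tail x (xs ++ ys) (length xs + k) ⟩
  IsRLmax (xs ++ ys) (suc (length xs + k))           ≡⟨ cong (IsRLmax (xs ++ ys)) (+-suc (length xs) k) ⟨
  IsRLmax (xs ++ ys) (length xs + suc k)             ∼⟨ IsRLmax-++ʳ xs ys refl k ⟩
  IsRLmax ys (suc k)                                 ∎

IsRLmax-++ˡ-dominated : ∀ {v} xs ys {i} → All (v ≤_) xs → All (_< v) ys → i ≤ length xs →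
                        IsRLmax (xs ++ ys) i ⇔ IsRLmax xs i
IsRLmax-++ˡ-dominated {v} xs ys v≤xs ys<v i≤∣xs∣ = ⇔-trans (IsRLmax-++ˡ xs ys i≤∣xs∣)
  (mk⇔ proj₁ (λ rl → rl , All.map (λ y<v → <-≤-trans y<v (v≤entry rl)) ys<v))
  where
  v≤entry : ∀ {i} → IsRLmax xs i → v ≤ at xs i
  v≤entry {suc _} (_ , i≤∣xs∣ , _) = All-at v≤xs i≤∣xs∣

OrderEmbeddingOn : (ℕ → Set) → (ℕ → ℕ) → Set
OrderEmbeddingOn P f = ∀ {x y} → P x → P y → x < y ⇔ f x < f y

strictMonoOn⇒orderEmbeddingOn : ∀ {f} → (∀ {x y} → P x → P y → x < y → f x < f y) →
                                OrderEmbeddingOn P f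
strictMonoOn⇒orderEmbeddingOn {f = f} mono {x} {y} px py = mk⇔ (mono px py) reflect
  where
  reflect : f x < f y → x < y
  reflect fx<fy with <-cmp x y
  ... | tri< x<y _ _  = x<y
  ... | tri≈ _ refl _ = contradiction fx<fy (<-irrefl refl)
  ... | tri> _ _ y<x  = contradiction (mono py px y<x) (<-asym fx<fy)

All-<-map : ∀ {f} → OrderEmbeddingOn P f → P x → All P xs → All (_< f x) (map f xs) ⇔ All (_< x) xs
All-<-map emb px []         = mk⇔ (λ _ → []) (λ _ → [])
All-<-map emb px (py ∷ pys) = mk⇔
  (λ { (q ∷ qs) → from (emb py px) q ∷ to (All-<-map emb px pys) qs })
  (λ { (q ∷ qs) → to (emb py px) q ∷ from (All-<-map emb px pys) qs })

IsRLmax-map : ∀ {f} → OrderEmbeddingOn P f → All P xs → ∀ i → IsRLmax (map f xs) i ⇔ IsRLmax xs i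
IsRLmax-map emb []         i    = ⇔-refl
IsRLmax-map emb (px ∷ pxs) zero = mk⇔ (λ { (() , _) }) (λ { (() , _) })
IsRLmax-map {f = f} emb (_∷_ {x} {xs} px pxs) (suc zero) = begin
  IsRLmax (f x ∷ map f xs) 1  ∼⟨ IsRLmax-∷-head (f x) (map f xs) ⟩
  All (_< f x) (map f xs)     ∼⟨ All-<-map emb px pxs ⟩
  All (_< x) xs               ∼⟨ ⇔-sym (IsRLmax-∷-head x xs) ⟩
  IsRLmax (x ∷ xs) 1          ∎
IsRLmax-map {f = f} emb (_∷_ {x} {xs} px pxs) (suc (suc k)) = begin
  IsRLmax (f x ∷ map f xs) (suc (suc k))  ∼⟨ IsRLmax-∷-tail (f x) (map f xs) k ⟩
  IsRLmax (map f xs) (suc k)              ∼⟨ IsRLmax-map emb pxs (suc k) ⟩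
  IsRLmax xs (suc k)                      ∼⟨ ⇔-sym (IsRLmax-∷-tail x xs k) ⟩
  IsRLmax (x ∷ xs) (suc (suc k))          ∎

-- σ̂_i = hat c d σ_i and α̂_i = offset c α_i, where c = σ_{a+1} and d = l - 1.
hat : ℕ → ℕ → ℕ → ℕ
hat c d x = if does (x <? c) then x else x + d

offset : ℕ → ℕ → ℕ
offset c x = x + c ∸ 1

hat-below : ∀ {c} d {x} → x < c → hat c d x ≡ x
hat-below {c} d {x} x<c with x <ᵇ c | <ᵇ-reflects-< x c
... | true  | _        = refl
... | false | ofⁿ x≮c = contradiction x<c x≮c

hat-above : ∀ {c} d {x} → c ≤ x → hat c d x ≡ x + d
hat-above {c} d {x} c≤x with x <ᵇ c | <ᵇ-reflects-< x c
... | true  | ofʸ x<c = contradiction x<c (≤⇒≯ c≤x)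
... | false | _       = refl

hat-mono-< : ∀ c d {x y} → x < y → hat c d x < hat c d y
hat-mono-< c d {x} {y} x<y with x <ᵇ c | <ᵇ-reflects-< x c | y <ᵇ c | <ᵇ-reflects-< y c
... | true  | _       | true  | _       = x<y
... | true  | _       | false | _       = <-≤-trans x<y (m≤m+n y d)
... | false | ofⁿ x≮c | true  | ofʸ y<c = contradiction (<-trans x<y y<c) x≮c
... | false | _       | false | _       = +-monoˡ-< d x<y

hat-orderEmbedding : ∀ c d → OrderEmbeddingOn U (hat c d)
hat-orderEmbedding c d = strictMonoOn⇒orderEmbeddingOn (λ _ _ → hat-mono-< c d)

offset-mono-≤ : ∀ c {x y} → x ≤ y → offset c x ≤ offset c y
offset-mono-≤ c x≤y = ∸-monoˡ-≤ 1 (+-monoˡ-≤ c x≤y)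

-- For c = 0 truncated subtraction gives offset c 0 ≡ offset c 1, hence the restriction to positive entries.
offset-orderEmbedding : ∀ c → OrderEmbeddingOn (1 ≤_) (offset c)
offset-orderEmbedding c = strictMonoOn⇒orderEmbeddingOn mono
  where
  mono : ∀ {x y} → 1 ≤ x → 1 ≤ y → x < y → offset c x < offset c y
  mono {suc x} {suc y} _ _ (s≤s x<y) = +-monoˡ-< c x<y

offset-≥ : ∀ c {x} → 1 ≤ x → c ≤ offset c x
offset-≥ c {suc x} _ = m≤n+m c x

hat-threshold : ∀ c d → hat c d c ≡ offset c (suc d)
hat-threshold c d = trans (hat-above d ≤-refl) (+-comm c d)

-- The α̂-block is topped by c + d = hat c d c, so it lies below hat c d t exactly when c < t.
All-offset<hat⇔ : ∀ {c d t} → All (_≤ suc d) α → suc d ∈ α →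
                  All (_< hat c d t) (map (offset c) α) ⇔ c < t
All-offset<hat⇔ {c = c} {d} {t} α≤1+d 1+d∈α = mk⇔
  (λ below → from (hat-orderEmbedding c d _ _) (top<hat⁻¹ (All.lookup (map⁻ below) 1+d∈α)))
  (λ c<t → map⁺ (All.map (λ x≤1+d → ≤-<-trans (offset-mono-≤ c x≤1+d) (top<hat (hat-mono-< c d c<t))) α≤1+d))
  where
  top<hat : hat c d c < hat c d t → offset c (suc d) < hat c d t
  top<hat = subst (_< hat c d t) (hat-threshold c d)
  top<hat⁻¹ : offset c (suc d) < hat c d t → hat c d c < hat c d t
  top<hat⁻¹ = subst (_< hat c d t) (sym (hat-threshold c d))

IsPerm-length : IsPerm l α → length α ≡ l
IsPerm-length {l} α-perm = trans (↭-length α-perm) (length-applyUpTo suc l)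

IsPerm-∈ : IsPerm l α → x ∈ α → 1 ≤ x × x ≤ l
IsPerm-∈ α-perm x∈α with ∈-applyUpTo⁻ suc (∈-resp-↭ α-perm x∈α)
... | _ , i<l , refl = s≤s z≤n , i<l

IsPerm-max : IsPerm (suc l) α → suc l ∈ α
IsPerm-max α-perm = ∈-resp-↭ (↭-sym α-perm) (∈-applyUpTo⁺ suc ≤-refl)

RLmax-interval-bounds : ∀ {a b d} → IsPerm (suc d) α → (∀ i → IsRLmax α i ⇔ (b ≤ a + i × i ≤ suc d)) →
                        a < b × b ≤ a + suc d
RLmax-interval-bounds {α} {a} {b} {d} α-perm hα = a<b , b≤a+l
  where
  a<b : a < b
  a<b = ≰⇒> λ b≤a → contradiction (proj₁ (from (hα 0) (subst (b ≤_) (sym (+-identityʳ a)) b≤a , z≤n))) λ ()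
  b≤a+l : b ≤ a + suc d
  b≤a+l = proj₁ (to (hα (suc d)) (IsRLmax-last α (IsPerm-length α-perm)))

module Inflation (σ α : List ℕ) (a d : ℕ) (α-perm : IsPerm (suc d) α) (a<∣σ∣ : a < length σ) where

  c : ℕ
  c = at σ (suc a)

  T D ĥT B ĥD : List ℕ
  T  = take a σ
  D  = drop (suc a) σ
  ĥT = map (hat c d) T
  B  = map (offset c) α
  ĥD = map (hat c d) D

  inflate≡ : inflate σ α a ≡ ĥT ++ B ++ ĥD
  inflate≡ = cong (λ e → map (hat c e) T ++ B ++ map (hat c e) D) (cong (_∸ 1) (IsPerm-length α-perm))

  σ≡ : T ++ c ∷ D ≡ σ
  σ≡ = take++at∷drop a σ a<∣σ∣

  ∣T∣≡a : length T ≡ a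
  ∣T∣≡a = length-take-≤ a σ (<⇒≤ a<∣σ∣)

  ∣ĥT∣≡a : length ĥT ≡ a
  ∣ĥT∣≡a = trans (length-map (hat c d) T) ∣T∣≡a

  ∣B∣≡1+d : length B ≡ suc d
  ∣B∣≡1+d = trans (length-map (offset c) α) (IsPerm-length α-perm)

  RLmax-before : ∀ {i} → i ≤ a → IsRLmax (inflate σ α a) i ⇔ IsRLmax σ i
  RLmax-before {zero}  _   = mk⇔ (λ { (() , _) }) (λ { (() , _) })
  RLmax-before {suc k} i≤a = begin
    IsRLmax (inflate σ α a) (suc k)                         ≡⟨ cong (λ L → IsRLmax L (suc k)) inflate≡ ⟩
    IsRLmax (ĥT ++ B ++ ĥD) (suc k)                         ∼⟨ IsRLmax-++ˡ ĥT _ (subst (suc k ≤_) (sym ∣ĥT∣≡a) i≤a) ⟩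
    (IsRLmax ĥT (suc k) × All (_< at ĥT (suc k)) (B ++ ĥD)) ≡⟨ cong (λ v → IsRLmax ĥT (suc k) × All (_< v) (B ++ ĥD))
                                                                   (at-map (hat c d) T i≤∣T∣) ⟩
    (IsRLmax ĥT (suc k) × All (_< hat c d t) (B ++ ĥD))     ∼⟨ ⇔-refl ×-⇔ All-++⇔ ⟩
    (IsRLmax ĥT (suc k) × All (_< hat c d t) B × All (_< hat c d t) ĥD)
      ∼⟨ IsRLmax-map (hat-orderEmbedding c d) (All.universal-U T) (suc k)
         ×-⇔ All-offset<hat⇔ α≤1+d (IsPerm-max α-perm)
         ×-⇔ All-<-map (hat-orderEmbedding c d) _ (All.universal-U D) ⟩
    (IsRLmax T (suc k) × c < t × All (_< t) D)              ∼⟨ ⇔-refl ×-⇔ All-∷⇔ ⟩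
    (IsRLmax T (suc k) × All (_< t) (c ∷ D))                ∼⟨ ⇔-sym (IsRLmax-++ˡ T (c ∷ D) i≤∣T∣) ⟩
    IsRLmax (T ++ c ∷ D) (suc k)                            ≡⟨ cong (λ τ → IsRLmax τ (suc k)) σ≡ ⟩
    IsRLmax σ (suc k)                                       ∎
    where
    t : ℕ
    t = at T (suc k)
    i≤∣T∣ : suc k ≤ length T
    i≤∣T∣ = subst (suc k ≤_) (sym ∣T∣≡a) i≤a
    α≤1+d : All (_≤ suc d) α
    α≤1+d = All.tabulate (proj₂ ∘ IsPerm-∈ α-perm)

  RLmax-inside : IsRLmax σ (suc a) → ∀ {k} → suc k ≤ suc d →
                 IsRLmax (inflate σ α a) (a + suc k) ⇔ IsRLmax α (suc k)
  RLmax-inside a+1-RLmax {k} k<l = begin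
    IsRLmax (inflate σ α a) (a + suc k) ≡⟨ cong (λ L → IsRLmax L (a + suc k)) inflate≡ ⟩
    IsRLmax (ĥT ++ B ++ ĥD) (a + suc k) ∼⟨ IsRLmax-++ʳ ĥT _ ∣ĥT∣≡a k ⟩
    IsRLmax (B ++ ĥD) (suc k)           ∼⟨ IsRLmax-++ˡ-dominated B ĥD c≤B ĥD<c (subst (suc k ≤_) (sym ∣B∣≡1+d) k<l) ⟩
    IsRLmax B (suc k)                   ∼⟨ IsRLmax-map (offset-orderEmbedding c) α≥1 (suc k) ⟩
    IsRLmax α (suc k)                   ∎
    where
    α≥1 : All (1 ≤_) α
    α≥1 = All.tabulate (proj₁ ∘ IsPerm-∈ α-perm)
    c≤B : All (c ≤_) B
    c≤B = map⁺ (All.map (offset-≥ c) α≥1)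
    D<c : All (_< c) D
    D<c = to (IsRLmax-∷-head c D) (to (IsRLmax-++ʳ T (c ∷ D) ∣T∣≡a 0)
            (subst₂ IsRLmax (sym σ≡) (+-comm 1 a) a+1-RLmax))
    ĥD<c : All (_< c) ĥD
    ĥD<c = map⁺ (All.map (λ x<c → subst (_< c) (sym (hat-below d x<c)) x<c) D<c)

  RLmax-after : ∀ k → IsRLmax (inflate σ α a) (a + suc d + suc k) ⇔ IsRLmax σ (suc a + suc k)
  RLmax-after k = begin
    IsRLmax (inflate σ α a) (a + suc d + suc k)   ≡⟨ cong₂ IsRLmax inflate≡ (+-assoc a (suc d) (suc k)) ⟩
    IsRLmax (ĥT ++ B ++ ĥD) (a + (suc d + suc k)) ∼⟨ IsRLmax-++ʳ ĥT _ ∣ĥT∣≡a (d + suc k) ⟩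
    IsRLmax (B ++ ĥD) (suc d + suc k)             ∼⟨ IsRLmax-++ʳ B ĥD ∣B∣≡1+d k ⟩
    IsRLmax ĥD (suc k)                            ∼⟨ IsRLmax-map (hat-orderEmbedding c d) (All.universal-U D) (suc k) ⟩
    IsRLmax D (suc k)                             ∼⟨ ⇔-sym (IsRLmax-∷-tail c D k) ⟩
    IsRLmax (c ∷ D) (suc (suc k))                 ∼⟨ ⇔-sym (IsRLmax-++ʳ T (c ∷ D) ∣T∣≡a (suc k)) ⟩
    IsRLmax (T ++ c ∷ D) (a + suc (suc k))        ≡⟨ cong₂ IsRLmax σ≡ (+-suc a (suc k)) ⟩
    IsRLmax σ (suc a + suc k)                     ∎

data Region (a l : ℕ) : ℕ → Set where
  before : ∀ {i} → i ≤ a → Region a l i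
  inside : ∀ k → suc k ≤ l → Region a l (a + suc k)
  after  : ∀ k → Region a l (a + l + suc k)

region : ∀ a l i → Region a l i
region a       l       zero    = before z≤n
region (suc a) l       (suc i) with region a l i
... | before i≤a   = before (s≤s i≤a)
... | inside k k<l = inside k k<l
... | after k      = after k
region zero    zero    (suc i) = after i
region zero    (suc l) (suc i) with region zero l i
... | before z≤n   = inside zero (s≤s z≤n)
... | inside k k<l = inside (suc k) (s≤s k<l)
... | after k      = after k

InPointsOrRange : List ℕ → ℕ → ℕ → ℕ → ℕ → Set
InPointsOrRange is a lo hi i = i ∈ is ⊎ i ≡ a ⊎ (lo ≤ i × i ≤ hi)

InPointsOrRange-below : ∀ {is a lo hi lo′ hi′ i} → i ≤ a → a < lo → a < lo′ →
                        InPointsOrRange is a lo hi i ⇔ InPointsOrRange is a lo′ hi′ i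
InPointsOrRange-below {a = a} {i = i} i≤a a<lo a<lo′ =
  ⇔-refl ⊎-⇔ ⇔-refl ⊎-⇔ mk⇔ (out-of-range a<lo) (out-of-range a<lo′)
  where
  out-of-range : ∀ {lo} {Q R : Set} → a < lo → lo ≤ i × R → Q
  out-of-range a<lo (lo≤i , _) = contradiction (≤-trans lo≤i i≤a) (<⇒≱ a<lo)

InPointsOrRange-above : ∀ {is a lo hi i} → All (_< a) is → a < i →
                        InPointsOrRange is a lo hi i ⇔ (lo ≤ i × i ≤ hi)
InPointsOrRange-above {is} {a} {lo} {hi} {i} is<a a<i = mk⇔ in-range (inj₂ ∘ inj₂)
  where
  in-range : InPointsOrRange is a lo hi i → lo ≤ i × i ≤ hi
  in-range (inj₁ i∈is)        = contradiction (All.lookup is<a i∈is) (<⇒≯ a<i)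
  in-range (inj₂ (inj₁ refl)) = contradiction a<i (<-irrefl refl)
  in-range (inj₂ (inj₂ q))    = q

block-≤ : ∀ {a d k m} → suc k ≤ suc d → a < m → a + suc k ≤ m + suc d ∸ 1
block-≤ {a} {d} {k} {m} k<l a<m = ≤-trans (+-monoʳ-≤ a k<l)
  (subst₂ _≤_ (sym (+-suc a d)) (cong (_∸ 1) (sym (+-suc m d))) (+-monoˡ-≤ d a<m))

suffix-≤⇔ : ∀ a d k m → (suc a + suc k ≤ m) ⇔ (a + suc d + suc k ≤ m + suc d ∸ 1)
suffix-≤⇔ a d k m =
  subst₂ (λ x y → (suc a + suc k ≤ m) ⇔ (x ≤ y)) (shuffle a d k) (cong (_∸ 1) (sym (+-suc m d)))
    (mk⇔ (+-monoˡ-≤ d) (+-cancelʳ-≤ d _ _))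
  where
  shuffle : ∀ a d k → suc a + suc k + d ≡ a + suc d + suc k
  shuffle = solve-∀

lemma5 : (m l : ℕ) → 1 ≤ m → 1 ≤ l →
         (σ α : List ℕ) → IsPerm m σ → IsPerm l α →
         (is : List ℕ) (a : ℕ) → Linked _<_ is → All (_< a) is →
         1 ≤ a → a + 1 ≤ m →
         (∀ i → IsRLmax σ i ⇔ (i ∈ is ⊎ i ≡ a ⊎ (a + 1 ≤ i × i ≤ m))) →
         (b : ℕ) → (∀ i → IsRLmax α i ⇔ (b ≤ a + i × i ≤ l)) →
         ∀ i → IsRLmax (inflate σ α a) i
               ⇔ (i ∈ is ⊎ i ≡ a ⊎ (b ≤ i × i ≤ m + l ∸ 1))
lemma5 m (suc d) _ _ σ α σ-perm α-perm is a _ is<a _ a+1≤m hσ b hα i = by-region (region a (suc d) i)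
  where
  n : ℕ
  n = m + suc d ∸ 1
  a<m : a < m
  a<m = subst (_≤ m) (+-comm a 1) a+1≤m
  open Inflation σ α a d α-perm (subst (a <_) (sym (IsPerm-length σ-perm)) a<m)
  a+1-RLmax : IsRLmax σ (suc a)
  a+1-RLmax = from (hσ (suc a)) (inj₂ (inj₂ (≤-reflexive (+-comm a 1) , a<m)))
  a<b×b≤a+l : a < b × b ≤ a + suc d
  a<b×b≤a+l = RLmax-interval-bounds α-perm hα

  by-region : ∀ {i} → Region a (suc d) i → IsRLmax (inflate σ α a) i ⇔ InPointsOrRange is a b n i
  by-region {i} (before i≤a) = begin
    IsRLmax (inflate σ α a) i                ∼⟨ RLmax-before i≤a ⟩
    IsRLmax σ i                              ∼⟨ hσ i ⟩
    InPointsOrRange is a (a + 1) m i         ∼⟨ InPointsOrRange-below i≤a (m<m+n a z<s) (proj₁ a<b×b≤a+l) ⟩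
    InPointsOrRange is a b n i               ∎
  by-region (inside k k<l) = begin
    IsRLmax (inflate σ α a) (a + suc k)      ∼⟨ RLmax-inside a+1-RLmax k<l ⟩
    IsRLmax α (suc k)                        ∼⟨ hα (suc k) ⟩
    (b ≤ a + suc k × suc k ≤ suc d)          ∼⟨ ⇔-refl ×-⇔ mk⇔ (λ _ → block-≤ k<l a<m) (λ _ → k<l) ⟩
    (b ≤ a + suc k × a + suc k ≤ n)          ∼⟨ ⇔-sym (InPointsOrRange-above is<a (m<m+n a z<s)) ⟩
    InPointsOrRange is a b n (a + suc k)     ∎
  by-region (after k) = begin
    IsRLmax (inflate σ α a) j                       ∼⟨ RLmax-after k ⟩
    IsRLmax σ (suc a + suc k)                       ∼⟨ hσ (suc a + suc k) ⟩
    InPointsOrRange is a (a + 1) m (suc a + suc k)  ∼⟨ InPointsOrRange-above is<a (s≤s (m≤m+n a (suc k))) ⟩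
    (a + 1 ≤ suc a + suc k × suc a + suc k ≤ m)     ∼⟨ mk⇔ (λ _ → ≤-trans (proj₂ a<b×b≤a+l) (m≤m+n _ _))
                                                           (λ _ → ≤-trans (≤-reflexive (+-comm a 1)) (m≤m+n (suc a) (suc k)))
                                                       ×-⇔ suffix-≤⇔ a d k m ⟩
    (b ≤ j × j ≤ n)                                 ∼⟨ ⇔-sym (InPointsOrRange-above is<a (<-≤-trans (m<m+n a z<s) (m≤m+n _ _))) ⟩
    InPointsOrRange is a b n j                      ∎
    where
    j : ℕ
    j = a + suc d + suc k
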